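{- Let $G$ be a simple graph of order $n\ge 2$ with $\chi(G)=2$. Then for every positive integer $t$, $\chi\big(S[G,t]\big)=2$.
   Context: Let $G$ be a simple graph with vertex set $V=\{1,\dots,n\}$, $n\ge 2$. For $t\ge 1$, the generalized Sierpiński graph $S(G,t)$ has vertex set $V^t$ (words $u_1u_2\cdots u_t$ over $V$), and two words ${\bf u}=u_1\cdots u_t$, ${\bf v}=v_1\cdots v_t$ are adjacent iff there is $i\in\{1,\dots,t\}$ with $u_j=v_j$ for $j<i$, $u_i\neq v_i$ and $u_iv_i\in E(G)$, and $u_j=v_i$, $v_j=u_i$ for all $j>i$. An edge of this kind with $i<t$ is called a linking edge. The generalized Sierpiński gasket $S[G,t]$ is the graph obtained from $S(G,t)$ by contracting all linking edges (so $S[G,1]=G$). $\chi$ denotes chromatic number. -}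

module Defs where

open import Data.Nat using (ℕ; suc; _<_; _≤_)
open import Data.Fin using (Fin; toℕ)
open import Data.Product using (Σ; ∃; _×_)
open import Relation.Nullary using (¬_)
open import Relation.Binary.PropositionalEquality using (_≡_; _≢_)
open import Relation.Binary.Construct.Closure.Equivalence using (EqClosure)

record SimpleGraph (n : ℕ) : Set₁ where
  field
    Adj   : Fin n → Fin n → Set
    sym   : ∀ {x y} → Adj x y → Adj y x
    irrefl : ∀ {x} → ¬ Adj x x
open SimpleGraph public

-- A graph whose vertex type carries an equivalence ("vertices up to _≈_");
-- used to represent a graph obtained by contraction without quotient types.
record SGraph : Set₁ where
  field
    V   : Set
    _≈_ : V → V → Set
    Adj : V → V → Set

Colouring : SGraph → ℕ → Set
Colouring H k = Σ (SGraph.V H → Fin k) λ c →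
  (∀ x y → SGraph._≈_ H x y → c x ≡ c y) ×
  (∀ x y → SGraph.Adj H x y → c x ≢ c y)

IsChromaticNumber : SGraph → ℕ → Set
IsChromaticNumber H k = Colouring H k × (∀ m → Colouring H m → k ≤ m)

asSGraph : ∀ {n} → SimpleGraph n → SGraph
asSGraph {n} G = record { V = Fin n ; _≈_ = _≡_ ; Adj = SimpleGraph.Adj G }

Word : ℕ → ℕ → Set
Word n t = Fin t → Fin n

AdjAt : ∀ {n t} → SimpleGraph n → Fin t → Word n t → Word n t → Set
AdjAt G i u v =
  (∀ j → toℕ j < toℕ i → u j ≡ v j) ×
  u i ≢ v i ×
  SimpleGraph.Adj G (u i) (v i) ×
  (∀ j → toℕ i < toℕ j → (u j ≡ v i) × (v j ≡ u i))

-- Linking edge of S(G,t): position i < t (0-based: toℕ i + 1 < t).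
Linking : ∀ {n t} → SimpleGraph n → Word n t → Word n t → Set
Linking {t = t} G u v = ∃ λ i → suc (toℕ i) < t × AdjAt G i u v

-- Non-linking edge of S(G,t): position i = t (0-based: toℕ i + 1 ≡ t).
NonLinking : ∀ {n t} → SimpleGraph n → Word n t → Word n t → Set
NonLinking {t = t} G u v = ∃ λ i → suc (toℕ i) ≡ t × AdjAt G i u v

Contracted : ∀ {n t} → SimpleGraph n → Word n t → Word n t → Set
Contracted G = EqClosure (Linking G)

-- The generalized Sierpiński gasket S[G,t]: S(G,t) with all linking edges
-- contracted.  Vertices are words up to `Contracted`; two classes are adjacent
-- iff they are distinct and some representatives are joined by a (non-linking)
-- edge of S(G,t) (loops removed; the result is a simple graph).
Gasket : ∀ {n} → SimpleGraph n → ℕ → SGraph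
Gasket {n} G t = record
  { V   = Word n t
  ; _≈_ = Contracted G
  ; Adj = λ x y → ¬ Contracted G x y ×
                  (∃ λ x′ → ∃ λ y′ → Contracted G x x′ × Contracted G y y′ × NonLinking G x′ y′)
  }

{-# OPTIONS --safe #-}
module Submission where

-- Colour a word u₁⋯u_t by c(u_{t-1}) + c(u_t) mod 2, where c is a proper
-- 2-colouring of G and c(u₀) := 0.  A linking edge at a position i < t-1 joins
-- two words that both end in a doubled letter, and one at position t-1 swaps
-- their last two letters, so this colour is constant on contracted classes; a
-- non-linking edge changes only the last letter, to a neighbour, so it flips
-- the colour.  Conversely every edge xy of G gives the edge x⋯x — x⋯xy of
-- S[G,t], so a 1-colouring of S[G,t] would leave G without edges.

open import Defs hiding (sym)
open import Data.Nat as ℕ using (ℕ; zero; suc; _≤_; z≤n; s≤s)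
import Data.Nat.Properties as ℕ
open import Data.Fin using (Fin; toℕ; fromℕ; inject₁; _<_)
open import Data.Fin.Patterns using (0F; 1F)
open import Data.Fin.Properties
  using (toℕ-fromℕ; toℕ-inject₁; toℕ-injective; ≤fromℕ; ≤∧≢⇒<; <⇒≢; ℕ<⇒inject₁<)
  renaming (_≟_ to _≟ᶠ_)
open import Data.Vec.Functional using (replicate; updateAt)
open import Data.Vec.Functional.Properties using (updateAt-updates; updateAt-minimal)
open import Data.Product using (_×_; _,_; proj₁; proj₂)
open import Function using (const)
open import Relation.Nullary using (¬_; yes; no; contradiction)
open import Relation.Binary.PropositionalEquality
open import Relation.Binary.Construct.Closure.Equivalence using (gfold; reflexive)
open ≡-Reasoning

_⊕_ : Fin 2 → Fin 2 → Fin 2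
0F ⊕ b  = b
1F ⊕ 0F = 1F
1F ⊕ 1F = 0F

⊕-self : ∀ a → a ⊕ a ≡ 0F
⊕-self 0F = refl
⊕-self 1F = refl

⊕-comm : ∀ a b → a ⊕ b ≡ b ⊕ a
⊕-comm 0F 0F = refl
⊕-comm 0F 1F = refl
⊕-comm 1F 0F = refl
⊕-comm 1F 1F = refl

⊕-cancelʳ : ∀ a b c → a ⊕ c ≡ b ⊕ c → a ≡ b
⊕-cancelʳ 0F 0F _  _ = refl
⊕-cancelʳ 1F 1F _  _ = refl
⊕-cancelʳ 0F 1F 0F ()
⊕-cancelʳ 0F 1F 1F ()
⊕-cancelʳ 1F 0F 0F ()
⊕-cancelʳ 1F 0F 1F ()

penultimate : ∀ m → Fin (suc (suc m))
penultimate m = inject₁ (fromℕ m)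

toℕ-penultimate : ∀ m → toℕ (penultimate m) ≡ m
toℕ-penultimate m = trans (toℕ-inject₁ (fromℕ m)) (toℕ-fromℕ m)

penultimate<fromℕ : ∀ m → penultimate m < fromℕ (suc m)
penultimate<fromℕ m = ℕ<⇒inject₁< (ℕ.n<1+n (toℕ (fromℕ m)))

Edgeless : SGraph → Set
Edgeless H = ∀ x y → ¬ SGraph.Adj H x y

module _ {H : SGraph} where

  edgeless⇒colouring₁ : Edgeless H → Colouring H 1
  edgeless⇒colouring₁ edgeless = const 0F , (λ _ _ _ → refl) , λ x y xy _ → edgeless x y xy

  colouring₁⇒edgeless : Colouring H 1 → Edgeless H
  colouring₁⇒edgeless (c , _ , proper) x y xy with c x | c y | proper x y xy
  ... | 0F | 0F | cx≢cy = cx≢cy refl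

  colouring⇒2≤ : SGraph.V H → ¬ Edgeless H → ∀ m → Colouring H m → 2 ≤ m
  colouring⇒2≤ x _ 0 (c , _) with c x
  ... | ()
  colouring⇒2≤ _ ¬edgeless 1 colouring = contradiction (colouring₁⇒edgeless colouring) ¬edgeless
  colouring⇒2≤ _ _ (suc (suc m)) _ = s≤s (s≤s z≤n)

module GasketColouringBy {n t} (G : SimpleGraph n) {m} (c : Word n t → Fin m)
         (linking⇒≡ : ∀ {u v} → Linking G u v → c u ≡ c v)
         (nonLinking⇒≢ : ∀ {u v} → NonLinking G u v → c u ≢ c v) where

  contracted⇒≡ : ∀ {u v} → Contracted G u v → c u ≡ c v
  contracted⇒≡ = gfold isEquivalence c linking⇒≡

  colouring : Colouring (Gasket G t) m
  colouring = c , (λ _ _ → contracted⇒≡) , adjacent⇒≢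
    where
    adjacent⇒≢ : ∀ u v → SGraph.Adj (Gasket G t) u v → c u ≢ c v
    adjacent⇒≢ u v (_ , u′ , v′ , u≈u′ , v≈v′ , u′v′) cu≡cv =
      nonLinking⇒≢ u′v′ (trans (sym (contracted⇒≡ u≈u′)) (trans cu≡cv (contracted⇒≡ v≈v′)))

  nonLinking⇒adjacent : ∀ {u v} → NonLinking G u v → SGraph.Adj (Gasket G t) u v
  nonLinking⇒adjacent uv =
    (λ u≈v → nonLinking⇒≢ uv (contracted⇒≡ u≈v)) , _ , _ , reflexive _ , reflexive _ , uv

edge⇒nonLinking : ∀ {n} (G : SimpleGraph n) k {x y} → Adj G x y →
  NonLinking {t = suc k} G (replicate _ x) (updateAt (replicate _ x) (fromℕ k) (const y))
edge⇒nonLinking {n} G k {x} {y} xy = fromℕ k , cong suc (toℕ-fromℕ k) , before , x≢y , xy′ , after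
  where
  xs xsy : Word n (suc k)
  xs  = replicate _ x
  xsy = updateAt xs (fromℕ k) (const y)
  before : ∀ j → j < fromℕ k → x ≡ xsy j
  before j j<k = sym (updateAt-minimal j (fromℕ k) xs (<⇒≢ j<k))
  xy′ : Adj G x (xsy (fromℕ k))
  xy′ = subst (Adj G x) (sym (updateAt-updates (fromℕ k) xs)) xy
  x≢y : x ≢ xsy (fromℕ k)
  x≢y x≡y = irrefl G (subst (Adj G x) (sym x≡y) xy′)
  after : ∀ j → fromℕ k < j → (x ≡ xsy (fromℕ k)) × (xsy j ≡ x)
  after j k<j = contradiction (≤fromℕ j) (ℕ.<⇒≱ k<j)

module GasketParity {n} (G : SimpleGraph n) (col : Fin n → Fin 2)
       (proper : ∀ x y → Adj G x y → col x ≢ col y) where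

  penultimateColour : ∀ k → Word n (suc k) → Fin 2
  penultimateColour zero    _ = 0F
  penultimateColour (suc m) u = col (u (penultimate m))

  gasketColour : ∀ k → Word n (suc k) → Fin 2
  gasketColour k u = col (u (fromℕ k)) ⊕ penultimateColour k u

  linking⇒gasketColour≡ : ∀ k {u v} → Linking G u v → gasketColour k u ≡ gasketColour k v
  linking⇒gasketColour≡ zero (_ , s≤s () , _)
  linking⇒gasketColour≡ (suc m) {u} {v} (i , s≤s (s≤s i≤m) , _ , _ , _ , after)
    with i ≟ᶠ penultimate m
  ... | yes refl = begin
    col (u lst) ⊕ col (u i) ≡⟨ cong (λ w → col w ⊕ col (u i)) (proj₁ (after lst (penultimate<fromℕ m))) ⟩
    col (v i)   ⊕ col (u i) ≡⟨ ⊕-comm (col (v i)) (col (u i)) ⟩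
    col (u i)   ⊕ col (v i) ≡⟨ cong (λ w → col w ⊕ col (v i)) (proj₂ (after lst (penultimate<fromℕ m))) ⟨
    col (v lst) ⊕ col (v i) ∎
    where
    lst : Fin (suc (suc m))
    lst = fromℕ (suc m)
  ... | no i≢pen = begin
    col (u lst) ⊕ col (u pen) ≡⟨ cong₂ (λ w w′ → col w ⊕ col w′) (proj₁ (after lst i<lst)) (proj₁ (after pen i<pen)) ⟩
    col (v i)   ⊕ col (v i)   ≡⟨ ⊕-self (col (v i)) ⟩
    0F                        ≡⟨ ⊕-self (col (u i)) ⟨
    col (u i)   ⊕ col (u i)   ≡⟨ cong₂ (λ w w′ → col w ⊕ col w′) (proj₂ (after lst i<lst)) (proj₂ (after pen i<pen)) ⟨
    col (v lst) ⊕ col (v pen) ∎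
    where
    lst pen : Fin (suc (suc m))
    lst = fromℕ (suc m)
    pen = penultimate m
    i<pen : i < pen
    i<pen = ≤∧≢⇒< (subst (toℕ i ℕ.≤_) (sym (toℕ-penultimate m)) i≤m) i≢pen
    i<lst : i < lst
    i<lst = ℕ.<-trans i<pen (penultimate<fromℕ m)

  penultimateColour-agrees : ∀ k {u v : Word n (suc k)} →
    (∀ j → j < fromℕ k → u j ≡ v j) → penultimateColour k u ≡ penultimateColour k v
  penultimateColour-agrees zero    _     = refl
  penultimateColour-agrees (suc m) agree = cong col (agree _ (penultimate<fromℕ m))

  nonLinking⇒gasketColour≢ : ∀ k {u v} → NonLinking G u v → gasketColour k u ≢ gasketColour k v
  nonLinking⇒gasketColour≢ k {u} {v} (i , 1+i≡1+k , before , _ , uv , _)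
    with toℕ-injective (trans (ℕ.suc-injective 1+i≡1+k) (sym (toℕ-fromℕ k)))
  ... | refl = λ eq → proper _ _ uv (⊕-cancelʳ _ _ _ (begin
    col (u i) ⊕ penultimateColour k u ≡⟨ eq ⟩
    col (v i) ⊕ penultimateColour k v ≡⟨ cong (col (v i) ⊕_) (penultimateColour-agrees k before) ⟨
    col (v i) ⊕ penultimateColour k u ∎))

mainTheorem5 : (n : ℕ) → 2 ≤ n → (G : SimpleGraph n) →
    IsChromaticNumber (asSGraph G) 2 →
    (t : ℕ) → 1 ≤ t → IsChromaticNumber (Gasket G t) 2
mainTheorem5 (suc n) (s≤s _) G ((col , _ , proper) , χ≥2) (suc k) (s≤s z≤n) =
  colouring , colouring⇒2≤ (const 0F) gasket-¬edgeless
  where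
  open GasketParity G col proper
  open GasketColouringBy G (gasketColour k) (linking⇒gasketColour≡ k) (nonLinking⇒gasketColour≢ k)
  G-¬edgeless : ¬ Edgeless (asSGraph G)
  G-¬edgeless edgeless = ℕ.n≮n 1 (χ≥2 1 (edgeless⇒colouring₁ edgeless))
  gasket-¬edgeless : ¬ Edgeless (Gasket G (suc k))
  gasket-¬edgeless edgeless =
    G-¬edgeless λ x y xy → edgeless _ _ (nonLinking⇒adjacent (edge⇒nonLinking G k xy))
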